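{- Let $G$ be a graph and $\theta$ a positive integer. If $\mathcal{E}$ is an edge-tangle in $G$ of order $\theta$ and $X\subseteq E(G)$ with $|X|<\theta$, then $\mathcal{E}-X$ is an edge-tangle in $G-X$ of order $\theta-|X|$.
   Context: Graphs are finite and may have loops and parallel edges. An edge-cut of $G$ is an ordered partition $[A,B]$ of $V(G)$ (parts may be empty); its order is the number of edges with one end in $A$ and one in $B$. An edge-tangle of order $\theta$ in $G$ is a set $\mathcal{E}$ of edge-cuts of order less than $\theta$ with (E1) for every edge-cut $[A,B]$ of order less than $\theta$, $[A,B]\in\mathcal{E}$ or $[B,A]\in\mathcal{E}$; (E2) if $[A_i,B_i]\in\mathcal{E}$, $i=1,2,3$, then $B_1\cap B_2\cap B_3\ne\emptyset$; (E3) if $[A,B]\in\mathcal{E}$ then at least $\theta$ edges of $G$ are incident with vertices of $B$. For $X\subseteq E(G)$, $G-X$ is $G$ with the edges of $X$ deleted, and for a set $\mathcal{E}$ of edge-cuts of $G$ of order less than $\theta$, $\mathcal{E}-X$ is the set of edge-cuts $[A,B]$ of $G-X$ of order (in $G-X$) less than $\theta-|X|$ such that $[A,B]\in\mathcal{E}$. -}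

module Defs where

open import Data.Nat using (ℕ; zero; suc; _+_; _<_; _≤_; _∸_)
open import Data.Bool using (Bool; true; false; not; _xor_; _∨_)
open import Data.Fin using (Fin)
open import Data.Fin.Subset using (Subset)
open import Data.Vec using (lookup)
open import Data.List using (List; []; _∷_; length; tabulate; map; filterᵇ)
import Data.List as List
open import Data.Sum using (_⊎_)
open import Data.Product using (_×_; _,_; proj₁; proj₂; Σ; ∃)
open import Relation.Binary.PropositionalEquality using (_≡_)

-- Loops (u , u) and parallel edges (repeated pairs)
-- are allowed; an edge is identified by its position in the list.
Graph : ℕ → Set
Graph n = List (Fin n × Fin n)

Edge : ∀ {n} → Graph n → Set
Edge G = Fin (length G)

countᵇ : ∀ {A : Set} → (A → Bool) → List A → ℕ
countᵇ p []       = 0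
countᵇ p (x ∷ xs) with p x
... | true  = suc (countᵇ p xs)
... | false = countᵇ p xs

-- An edge-cut [A,B] of G is an ordered partition of V(G); it is determined by
-- its first part A (a subset of Fin n), the second part being B = V(G) ∖ A.
Cut : ℕ → Set
Cut n = Subset n

inB : ∀ {n} → Cut n → Fin n → Bool
inB A v = not (lookup A v)

order : ∀ {n} → Graph n → Cut n → ℕ
order G A = countᵇ (λ e → lookup A (proj₁ e) xor lookup A (proj₂ e)) G

incidentB : ∀ {n} → Graph n → Cut n → ℕ
incidentB G A = countᵇ (λ e → inB A (proj₁ e) ∨ inB A (proj₂ e)) G

rev : ∀ {n} → Cut n → Cut n
rev A = Data.Vec.map not A

CutSet : ℕ → Set₁
CutSet n = Cut n → Set

record IsEdgeTangle {n : ℕ} (G : Graph n) (θ : ℕ) (ℰ : CutSet n) : Set where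
  field
    small : ∀ A → ℰ A → order G A < θ
    E1 : ∀ A → order G A < θ → ℰ A ⊎ ℰ (rev A)
    E2 : ∀ A₁ A₂ A₃ → ℰ A₁ → ℰ A₂ → ℰ A₃ →
         ∃ λ v → (inB A₁ v ≡ true) × (inB A₂ v ≡ true) × (inB A₃ v ≡ true)
    E3 : ∀ A → ℰ A → θ ≤ incidentB G A

deleteEdges : ∀ {n} (G : Graph n) → Subset (length G) → Graph n
deleteEdges G X =
  map proj₂ (filterᵇ (λ p → not (lookup X (proj₁ p)))
                     (tabulate (λ i → (i , List.lookup G i))))

tangleMinus : ∀ {n} (G : Graph n) (θ : ℕ) → CutSet n → Subset (length G) → CutSet n
tangleMinus G θ ℰ X A = (order (deleteEdges G X) A < θ ∸ Data.Fin.Subset.∣ X ∣) × ℰ A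

-- Deleting an edge changes the order of a cut, and the number of edges meeting
-- its second part, by at most one.  So a cut of order < θ − |X| in G − X has
-- order < θ in G, which makes (E1) follow from (E1) for ℰ, and (E3) for ℰ
-- loses at most |X| incident edges; (E2) is inherited verbatim.  Reversing a
-- cut does not change its order, as needed for the second alternative of (E1).
module Submission where

open import Defs
open import Data.Nat using (ℕ; suc; _+_; _≤_; _<_; _∸_; z≤n; s≤s)
open import Data.Nat.Properties
  using (≤-trans; n≤1+n; +-suc; <⇒≤; +-monoʳ-<; m+[n∸m]≡n; m≤n+o⇒m∸n≤o; module ≤-Reasoning)
open import Data.Bool using (Bool; true; false; not; _xor_)
open import Data.Bool.Properties using (not-involutive; not-distribˡ-xor; not-distribʳ-xor)
open import Data.Fin using (Fin)
import Data.Fin as Fin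
open import Data.Fin.Subset using (Subset; ∣_∣)
open import Data.Vec using (Vec; []; _∷_; lookup)
open import Data.Vec.Properties using (lookup-map)
open import Data.List using (List; []; _∷_; length; tabulate; map; filterᵇ)
import Data.List as List
import Data.Sum as Sum
open import Data.Product using (_×_; _,_; proj₁; proj₂)
open import Relation.Binary.PropositionalEquality using (_≡_; refl; sym; trans; cong; cong₂; subst; module ≡-Reasoning)

unmarked : ∀ {A : Set} (xs : List A) → Vec Bool (length xs) → List A
unmarked []       []          = []
unmarked (x ∷ xs) (true  ∷ X) = unmarked xs X
unmarked (x ∷ xs) (false ∷ X) = x ∷ unmarked xs X

-- The positions are relabelled by an arbitrary g, since tabulating the tail
-- of a list relabels them through Fin.suc.
map-proj₂-filterᵇ-tabulate : ∀ {A I : Set} (xs : List A) (X : Vec Bool (length xs))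
  (g : Fin (length xs) → I) (keep : I → Bool) → (∀ i → keep (g i) ≡ not (lookup X i)) →
  map proj₂ (filterᵇ (λ q → keep (proj₁ q)) (tabulate (λ i → g i , List.lookup xs i)))
    ≡ unmarked xs X
map-proj₂-filterᵇ-tabulate []       []      g keep keep≗ = refl
map-proj₂-filterᵇ-tabulate (x ∷ xs) (b ∷ X) g keep keep≗ with keep (g Fin.zero) | keep≗ Fin.zero
map-proj₂-filterᵇ-tabulate (x ∷ xs) (true  ∷ X) g keep keep≗ | .false | refl =
  map-proj₂-filterᵇ-tabulate xs X (λ i → g (Fin.suc i)) keep (λ i → keep≗ (Fin.suc i))
map-proj₂-filterᵇ-tabulate (x ∷ xs) (false ∷ X) g keep keep≗ | .true  | refl =
  cong (x ∷_) (map-proj₂-filterᵇ-tabulate xs X (λ i → g (Fin.suc i)) keep (λ i → keep≗ (Fin.suc i)))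

deleteEdges≡unmarked : ∀ {n} (G : Graph n) (X : Subset (length G)) → deleteEdges G X ≡ unmarked G X
deleteEdges≡unmarked G X = map-proj₂-filterᵇ-tabulate G X (λ i → i) (λ i → not (lookup X i)) (λ _ → refl)

countᵇ≤∣marked∣+countᵇ-unmarked : ∀ {A : Set} (p : A → Bool) (xs : List A) (X : Vec Bool (length xs)) →
  countᵇ p xs ≤ ∣ X ∣ + countᵇ p (unmarked xs X)
countᵇ≤∣marked∣+countᵇ-unmarked p []       []          = z≤n
countᵇ≤∣marked∣+countᵇ-unmarked p (x ∷ xs) (true ∷ X)  with p x
... | true  = s≤s (countᵇ≤∣marked∣+countᵇ-unmarked p xs X)
... | false = ≤-trans (countᵇ≤∣marked∣+countᵇ-unmarked p xs X) (n≤1+n _)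
countᵇ≤∣marked∣+countᵇ-unmarked p (x ∷ xs) (false ∷ X) with p x
... | true  = subst (suc (countᵇ p xs) ≤_) (sym (+-suc ∣ X ∣ _)) (s≤s (countᵇ≤∣marked∣+countᵇ-unmarked p xs X))
... | false = countᵇ≤∣marked∣+countᵇ-unmarked p xs X

countᵇ≤∣X∣+countᵇ-deleteEdges : ∀ {n} (p : Fin n × Fin n → Bool) (G : Graph n) (X : Subset (length G)) →
  countᵇ p G ≤ ∣ X ∣ + countᵇ p (deleteEdges G X)
countᵇ≤∣X∣+countᵇ-deleteEdges p G X
  rewrite deleteEdges≡unmarked G X = countᵇ≤∣marked∣+countᵇ-unmarked p G X

countᵇ-cong : ∀ {A : Set} {p q : A → Bool} → (∀ x → p x ≡ q x) → ∀ xs → countᵇ p xs ≡ countᵇ q xs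
countᵇ-cong p≗q []                   = refl
countᵇ-cong {p = p} {q} p≗q (x ∷ xs) with p x | q x | p≗q x
... | true  | .true  | refl = cong suc (countᵇ-cong p≗q xs)
... | false | .false | refl = countᵇ-cong p≗q xs

not-xor-not : ∀ a b → not a xor not b ≡ a xor b
not-xor-not a b = begin
  not a xor not b     ≡⟨ not-distribˡ-xor a (not b) ⟨
  not (a xor not b)   ≡⟨ cong not (not-distribʳ-xor a b) ⟨
  not (not (a xor b)) ≡⟨ not-involutive (a xor b) ⟩
  a xor b             ∎
  where open ≡-Reasoning

order-rev : ∀ {n} (G : Graph n) (A : Cut n) → order G (rev A) ≡ order G A
order-rev G A = countᵇ-cong crosses-rev G
  where
  crosses-rev : ∀ e → lookup (rev A) (proj₁ e) xor lookup (rev A) (proj₂ e)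
                    ≡ lookup A (proj₁ e) xor lookup A (proj₂ e)
  crosses-rev (u , v) =
    trans (cong₂ _xor_ (lookup-map u not A) (lookup-map v not A)) (not-xor-not (lookup A u) (lookup A v))

lemma2p4 : ∀ {n : ℕ} (G : Graph n) (θ : ℕ) → 0 < θ →
    (ℰ : CutSet n) → IsEdgeTangle G θ ℰ →
    (X : Subset (length G)) → ∣ X ∣ < θ →
    IsEdgeTangle (deleteEdges G X) (θ ∸ ∣ X ∣) (tangleMinus G θ ℰ X)
lemma2p4 {n} G θ _ ℰ tangle X ∣X∣<θ = record
  { small = λ _ → proj₁
  ; E1    = λ A small → Sum.map (small ,_) (subst (_< θ ∸ ∣ X ∣) (sym (order-rev G-X A)) small ,_)
                                 (E1 A (small-in-G A small))
  ; E2    = λ A₁ A₂ A₃ (_ , a₁) (_ , a₂) (_ , a₃) → E2 A₁ A₂ A₃ a₁ a₂ a₃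
  ; E3    = λ A (_ , a) → m≤n+o⇒m∸n≤o θ ∣ X ∣ (≤-trans (E3 A a) (countᵇ≤∣X∣+countᵇ-deleteEdges _ G X))
  }
  where
  open IsEdgeTangle tangle
  open ≤-Reasoning
  G-X : Graph n
  G-X = deleteEdges G X
  small-in-G : ∀ A → order G-X A < θ ∸ ∣ X ∣ → order G A < θ
  small-in-G A small = begin-strict
    order G A                 ≤⟨ countᵇ≤∣X∣+countᵇ-deleteEdges _ G X ⟩
    ∣ X ∣ + order G-X A       <⟨ +-monoʳ-< ∣ X ∣ small ⟩
    ∣ X ∣ + (θ ∸ ∣ X ∣)       ≡⟨ m+[n∸m]≡n (<⇒≤ ∣X∣<θ) ⟩
    θ                         ∎
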